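{- For every nonnegative integer $n$, $$64^n\sum_{k=0}^n\binom{ -1/4}k^2\binom{ -3/4}{n-k}^2=\sum_{k=0}^n\binom{2k}k^3\binom{2(n-k)}{n-k}16^{n-k}.$$
   Context: For real $a$ and a nonnegative integer $k$, $\binom{a}{k}=\frac{a(a-1)\cdots(a-k+1)}{k!}$ (with $\binom a0=1$). -}

module Defs where

open import Data.Nat as ℕ using (ℕ; zero; suc)
open import Data.Nat.Base using (_!)
open import Data.Nat.Properties using (_!≢0)
open import Data.Integer as ℤ using (ℤ; +_; -[1+_])
open import Data.Rational as ℚ using (ℚ; _+_; _*_; _-_; _/_; 1ℚ; 0ℚ)

nat : ℕ → ℚ
nat k = (+ k) / 1

falling : ℚ → ℕ → ℚ
falling a zero = 1ℚ
falling a (suc k) = falling a k * (a - nat k)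

binom : ℚ → ℕ → ℚ
binom a k = falling a k * ((+ 1) / (k !)) {{k !≢0}}

sumTo : ℕ → (ℕ → ℚ) → ℚ
sumTo zero f = f 0
sumTo (suc n) f = sumTo n f + f (suc n)

_^_ : ℚ → ℕ → ℚ
q ^ zero = 1ℚ
q ^ suc n = q * (q ^ n)

-- Put x = 64z.  The sequences u, v, w, c are the coefficients of ₂F₁(¼,¼;1;x),
-- ₂F₁(¾,¾;1;x), (1 − x)^(−1/2) and ₃F₂(½,½,½;1,1;x), and the two sides of the identity are
-- the Cauchy products (u ⋆ v)(n) and (c ⋆ w)(n).  Euler's transformation gives v = u ⋆ w
-- and Clausen's formula gives u ⋆ u = c, so associativity of ⋆ finishes the proof.  Each of
-- the two formulas is proved by showing that both sides satisfy the same first-order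
-- recurrence, the recurrence for the convolution coming from creative telescoping with an
-- explicit certificate.

module Submission where

open import Defs
open import Data.Nat as ℕ using (ℕ; zero; suc; _∸_; _≤_; z≤n; _!)
open import Data.Nat.Combinatorics using (_C_)
open import Data.Integer using (+_; -[1+_])
open import Data.Rational using (ℚ; _*_; _/_)

open import Data.List.Base using (_∷_; [])
import Data.Nat.Properties as ℕP
open import Data.Nat.Properties using (_!≢0)
open import Data.Nat.Combinatorics using (nCk≡n!/k![n-k]!; k![n∸k]!∣n!)
open import Data.Nat.DivMod using (m/n*n≡m)
import Data.Nat.Tactic.RingSolver as ℕ-Solver
open import Data.Nat.Coprimality as Coprimality using ()
import Data.Integer.Properties as ℤP
open import Data.Rational as ℚ using (mkℚ; _+_; _-_; 1ℚ; 0ℚ; toℚᵘ; _≟_)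
import Data.Rational.Properties as ℚP
import Data.Rational.Unnormalised as ℚᵘ
import Data.Rational.Unnormalised.Properties as ℚᵘP
open import Algebra.Bundles using (CommutativeMonoid)
import Algebra.Properties.CommutativeSemigroup as CommSemigroupProperties
open import Tactic.RingSolver using (solve-∀; solve)
open import Tactic.RingSolver.Core.AlmostCommutativeRing using (AlmostCommutativeRing; fromCommutativeRing)
open import Relation.Nullary.Decidable using (dec⇒maybe)
open import Relation.Binary.PropositionalEquality
open import Level using (0ℓ)
open import Function.Base using (_∘_)

ℚ-ring : AlmostCommutativeRing 0ℓ 0ℓ
ℚ-ring = fromCommutativeRing ℚP.+-*-commutativeRing (λ x → dec⇒maybe (0ℚ ≟ x))

open CommSemigroupProperties (CommutativeMonoid.commutativeSemigroup ℚP.+-0-commutativeMonoid)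
  using (interchange; x∙yz≈xz∙y; xy∙z≈xz∙y)

*-cancelˡ-≡ : ∀ {c x y} → c ≢ 0ℚ → c * x ≡ c * y → x ≡ y
*-cancelˡ-≡ {c} {x} {y} c≢0 cx≡cy = begin
  x                ≡⟨ ℚP.*-identityˡ x ⟨
  1ℚ * x           ≡⟨ cong (_* x) (ℚP.*-inverseˡ c) ⟨
  c⁻¹ * c * x      ≡⟨ ℚP.*-assoc c⁻¹ c x ⟩
  c⁻¹ * (c * x)    ≡⟨ cong (c⁻¹ *_) cx≡cy ⟩
  c⁻¹ * (c * y)    ≡⟨ ℚP.*-assoc c⁻¹ c y ⟨
  c⁻¹ * c * y      ≡⟨ cong (_* y) (ℚP.*-inverseˡ c) ⟩
  1ℚ * y           ≡⟨ ℚP.*-identityˡ y ⟩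
  y                ∎
  where
  open ≡-Reasoning
  instance
    c-nonZero : ℚ.NonZero c
    c-nonZero = ℚ.≢-nonZero c≢0
  c⁻¹ : ℚ
  c⁻¹ = ℚ.1/ c

p*q≢0 : ∀ {p q} → p ≢ 0ℚ → q ≢ 0ℚ → p * q ≢ 0ℚ
p*q≢0 {p} p≢0 q≢0 pq≡0 = q≢0 (*-cancelˡ-≡ p≢0 (trans pq≡0 (sym (ℚP.*-zeroʳ p))))

^-distribˡ-+-* : ∀ q m n → q ^ (m ℕ.+ n) ≡ q ^ m * q ^ n
^-distribˡ-+-* q zero    n = sym (ℚP.*-identityˡ (q ^ n))
^-distribˡ-+-* q (suc m) n = trans (cong (q *_) (^-distribˡ-+-* q m n)) (sym (ℚP.*-assoc q (q ^ m) (q ^ n)))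

nat≡mkℚ : ∀ n → nat n ≡ mkℚ (+ n) 0 (Coprimality.sym (Coprimality.1-coprimeTo n))
nat≡mkℚ n = ℚP.normalize-coprime _

nat-+ : ∀ m n → nat (m ℕ.+ n) ≡ nat m + nat n
nat-+ m n rewrite nat≡mkℚ m | nat≡mkℚ n | ℤP.*-identityʳ (+ m) | ℤP.*-identityʳ (+ n) = refl

nat-* : ∀ m n → nat (m ℕ.* n) ≡ nat m * nat n
nat-* m n rewrite nat≡mkℚ m | nat≡mkℚ n | sym (ℤP.pos-* m n) = refl

nat-suc : ∀ n → nat (suc n) ≡ nat n + 1ℚ
nat-suc n = trans (cong nat (ℕP.+-comm 1 n)) (nat-+ n 1)

nat+1≢0 : ∀ n → nat n + 1ℚ ≢ 0ℚ
nat+1≢0 n eq with trans (trans (sym (nat≡mkℚ (suc n))) (nat-suc n)) eq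
... | ()

nat*1/[m*n]≡1/n : ∀ m n .{{_ : ℕ.NonZero m}} .{{_ : ℕ.NonZero n}} →
                  nat m * ((+ 1) / (m ℕ.* n)) {{ℕP.m*n≢0 m n}} ≡ (+ 1) / n
nat*1/[m*n]≡1/n (suc a) (suc d) = ℚP.toℚᵘ-injective (begin
  toℚᵘ (nat (suc a) * ((+ 1) / (suc a ℕ.* suc d)))
    ≈⟨ ℚP.toℚᵘ-homo-* (nat (suc a)) ((+ 1) / (suc a ℕ.* suc d)) ⟩
  toℚᵘ (nat (suc a)) ℚᵘ.* toℚᵘ ((+ 1) / (suc a ℕ.* suc d))
    ≈⟨ ℚᵘP.*-cong (ℚP.toℚᵘ-fromℚᵘ (ℚᵘ.mkℚᵘ (+ suc a) 0)) (ℚP.toℚᵘ-fromℚᵘ (ℚᵘ.mkℚᵘ (+ 1) (d ℕ.+ a ℕ.* suc d))) ⟩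
  ℚᵘ.mkℚᵘ (+ suc a) 0 ℚᵘ.* ℚᵘ.mkℚᵘ (+ 1) (d ℕ.+ a ℕ.* suc d)
    ≈⟨ ℚᵘ.*≡* (cong +_ (ℕ-Solver.solve (a ∷ d ∷ []))) ⟩
  ℚᵘ.mkℚᵘ (+ 1) d
    ≈⟨ ℚP.toℚᵘ-fromℚᵘ (ℚᵘ.mkℚᵘ (+ 1) d) ⟨
  toℚᵘ ((+ 1) / suc d) ∎)
  where open import Relation.Binary.Reasoning.Setoid ℚᵘP.≃-setoid

-- Finite sums and Cauchy products

sumTo-cong : ∀ n {f g : ℕ → ℚ} → (∀ {k} → k ≤ n → f k ≡ g k) → sumTo n f ≡ sumTo n g
sumTo-cong zero    f≗g = f≗g z≤n
sumTo-cong (suc n) f≗g = cong₂ _+_ (sumTo-cong n (f≗g ∘ ℕP.m≤n⇒m≤1+n)) (f≗g ℕP.≤-refl)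

sumTo-distrib-+ : ∀ n (f g : ℕ → ℚ) → sumTo n (λ k → f k + g k) ≡ sumTo n f + sumTo n g
sumTo-distrib-+ zero    f g = refl
sumTo-distrib-+ (suc n) f g = trans (cong (_+ (f (suc n) + g (suc n))) (sumTo-distrib-+ n f g))
                                    (interchange (sumTo n f) (sumTo n g) (f (suc n)) (g (suc n)))

*-distribˡ-sumTo : ∀ c n (f : ℕ → ℚ) → c * sumTo n f ≡ sumTo n (λ k → c * f k)
*-distribˡ-sumTo c zero    f = refl
*-distribˡ-sumTo c (suc n) f = trans (ℚP.*-distribˡ-+ c (sumTo n f) (f (suc n)))
                                     (cong (_+ c * f (suc n)) (*-distribˡ-sumTo c n f))

sumTo-telescope : ∀ n (A B H : ℕ → ℚ) → (∀ {k} → k ≤ n → A k + H (suc k) ≡ B k + H k) →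
                  sumTo n A + H (suc n) ≡ sumTo n B + H 0
sumTo-telescope zero    A B H step = step z≤n
sumTo-telescope (suc n) A B H step = begin
  sumTo n A + A (suc n) + H (suc (suc n))     ≡⟨ ℚP.+-assoc (sumTo n A) (A (suc n)) _ ⟩
  sumTo n A + (A (suc n) + H (suc (suc n)))   ≡⟨ cong (λ t → sumTo n A + t) (step ℕP.≤-refl) ⟩
  sumTo n A + (B (suc n) + H (suc n))         ≡⟨ x∙yz≈xz∙y (sumTo n A) (B (suc n)) (H (suc n)) ⟩
  sumTo n A + H (suc n) + B (suc n)           ≡⟨ cong (_+ B (suc n)) (sumTo-telescope n A B H (step ∘ ℕP.m≤n⇒m≤1+n)) ⟩
  sumTo n B + H 0 + B (suc n)                 ≡⟨ xy∙z≈xz∙y (sumTo n B) (H 0) (B (suc n)) ⟩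
  sumTo n B + B (suc n) + H 0                 ∎
  where
  open ≡-Reasoning

sumTo-exchange : ∀ n (F : ℕ → ℕ → ℚ) →
                 sumTo n (λ k → sumTo (n ∸ k) (F k)) ≡ sumTo n (λ s → sumTo s (λ k → F k (s ∸ k)))
sumTo-exchange zero    F = refl
sumTo-exchange (suc n) F = begin
  sumTo n (λ k → sumTo (suc n ∸ k) (F k)) + sumTo (n ∸ n) (F (suc n))
    ≡⟨ cong₂ _+_ (sumTo-cong n peel-last) (cong (λ j → sumTo j (F (suc n))) (ℕP.n∸n≡0 n)) ⟩
  sumTo n (λ k → sumTo (n ∸ k) (F k) + F k (suc n ∸ k)) + F (suc n) 0
    ≡⟨ cong (_+ F (suc n) 0) (sumTo-distrib-+ n _ _) ⟩
  sumTo n (λ k → sumTo (n ∸ k) (F k)) + sumTo n (λ k → F k (suc n ∸ k)) + F (suc n) 0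
    ≡⟨ ℚP.+-assoc (sumTo n (λ k → sumTo (n ∸ k) (F k))) _ _ ⟩
  sumTo n (λ k → sumTo (n ∸ k) (F k)) + (sumTo n (λ k → F k (suc n ∸ k)) + F (suc n) 0)
    ≡⟨ cong₂ _+_ (sumTo-exchange n F) (cong (λ j → sumTo n (λ k → F k (suc n ∸ k)) + F (suc n) j) (sym (ℕP.n∸n≡0 n))) ⟩
  sumTo (suc n) (λ s → sumTo s (λ k → F k (s ∸ k))) ∎
  where
  open ≡-Reasoning
  peel-last : ∀ {k} → k ≤ n → sumTo (suc n ∸ k) (F k) ≡ sumTo (n ∸ k) (F k) + F k (suc n ∸ k)
  peel-last k≤n rewrite ℕP.+-∸-assoc 1 k≤n = refl

infixl 7 _⋆_

_⋆_ : (ℕ → ℚ) → (ℕ → ℚ) → ℕ → ℚ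
(f ⋆ g) n = sumTo n (λ k → f k * g (n ∸ k))

⋆-assoc : ∀ f g h n → (f ⋆ (g ⋆ h)) n ≡ ((f ⋆ g) ⋆ h) n
⋆-assoc f g h n = begin
  sumTo n (λ k → f k * sumTo (n ∸ k) (λ j → g j * h (n ∸ k ∸ j)))
    ≡⟨ sumTo-cong n (λ {k} _ → *-distribˡ-sumTo (f k) (n ∸ k) _) ⟩
  sumTo n (λ k → sumTo (n ∸ k) (λ j → f k * (g j * h (n ∸ k ∸ j))))
    ≡⟨ sumTo-exchange n (λ k j → f k * (g j * h (n ∸ k ∸ j))) ⟩
  sumTo n (λ s → sumTo s (λ k → f k * (g (s ∸ k) * h (n ∸ k ∸ (s ∸ k)))))
    ≡⟨ sumTo-cong n inner-sum ⟩
  sumTo n (λ s → (f ⋆ g) s * h (n ∸ s)) ∎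
  where
  open ≡-Reasoning
  inner-sum : ∀ {s} → s ≤ n → sumTo s (λ k → f k * (g (s ∸ k) * h (n ∸ k ∸ (s ∸ k)))) ≡ (f ⋆ g) s * h (n ∸ s)
  inner-sum {s} s≤n = begin
    sumTo s (λ k → f k * (g (s ∸ k) * h (n ∸ k ∸ (s ∸ k))))
      ≡⟨ sumTo-cong s (λ {k} k≤s → trans (cong (λ j → f k * (g (s ∸ k) * h j)) (n∸k∸[s∸k]≡n∸s k≤s))
                                         (sym (ℚP.*-assoc (f k) (g (s ∸ k)) (h (n ∸ s))))) ⟩
    sumTo s (λ k → f k * g (s ∸ k) * h (n ∸ s))
      ≡⟨ sumTo-cong s (λ {k} _ → ℚP.*-comm (f k * g (s ∸ k)) (h (n ∸ s))) ⟩
    sumTo s (λ k → h (n ∸ s) * (f k * g (s ∸ k)))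
      ≡⟨ *-distribˡ-sumTo (h (n ∸ s)) s _ ⟨
    h (n ∸ s) * (f ⋆ g) s
      ≡⟨ ℚP.*-comm (h (n ∸ s)) _ ⟩
    (f ⋆ g) s * h (n ∸ s) ∎
    where
    n∸k∸[s∸k]≡n∸s : ∀ {k} → k ≤ s → n ∸ k ∸ (s ∸ k) ≡ n ∸ s
    n∸k∸[s∸k]≡n∸s {k} k≤s = trans (ℕP.∸-+-assoc n k (s ∸ k)) (cong (n ∸_) (ℕP.m+[n∸m]≡n k≤s))

-- Creative telescoping: G k j is the certificate at the point k + j = n + 1 of the
-- antidiagonal, so that summing the local identity over k leaves only G 0 (n + 1) and G (n + 1) 0.
⋆-recurrence : ∀ (f g p q : ℕ → ℚ) (G : ℕ → ℕ → ℚ) →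
               (∀ j → G 0 j ≡ 0ℚ) →
               (∀ n → G (suc n) 0 ≡ p n * (f (suc n) * g 0)) →
               (∀ k m → p (k ℕ.+ m) * (f k * g (suc m)) + G (suc k) m
                        ≡ q (k ℕ.+ m) * (f k * g m) + G k (suc m)) →
               ∀ n → p n * (f ⋆ g) (suc n) ≡ q n * (f ⋆ g) n
⋆-recurrence f g p q G G-left G-right certificate n = begin
  p n * (sumTo n (λ k → f k * g (suc n ∸ k)) + f (suc n) * g (n ∸ n))
    ≡⟨ ℚP.*-distribˡ-+ (p n) _ _ ⟩
  p n * sumTo n (λ k → f k * g (suc n ∸ k)) + p n * (f (suc n) * g (n ∸ n))
    ≡⟨ cong₂ _+_ (*-distribˡ-sumTo (p n) n _) (last-term (ℕP.n∸n≡0 n)) ⟩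
  sumTo n A + H (suc n)
    ≡⟨ sumTo-telescope n A B H step ⟩
  sumTo n B + G 0 (suc n)
    ≡⟨ trans (cong (λ t → sumTo n B + t) (G-left (suc n))) (ℚP.+-identityʳ (sumTo n B)) ⟩
  sumTo n B
    ≡⟨ *-distribˡ-sumTo (q n) n _ ⟨
  q n * (f ⋆ g) n ∎
  where
  open ≡-Reasoning
  A B H : ℕ → ℚ
  A k = p n * (f k * g (suc n ∸ k))
  B k = q n * (f k * g (n ∸ k))
  H k = G k (suc n ∸ k)
  last-term : ∀ {j} → j ≡ 0 → p n * (f (suc n) * g j) ≡ G (suc n) j
  last-term refl = sym (G-right n)
  step : ∀ {k} → k ≤ n → A k + H (suc k) ≡ B k + H k
  step {k} k≤n rewrite ℕP.+-∸-assoc 1 k≤n =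
    subst (λ N → p N * (f k * g (suc (n ∸ k))) + G (suc k) (n ∸ k) ≡ q N * (f k * g (n ∸ k)) + G k (suc (n ∸ k)))
          (ℕP.m+[n∸m]≡n k≤n) (certificate k (n ∸ k))

recurrence-unique : ∀ (p q x y : ℕ → ℚ) → (∀ n → p n ≢ 0ℚ) →
                    (∀ n → p n * x (suc n) ≡ q n * x n) →
                    (∀ n → p n * y (suc n) ≡ q n * y n) →
                    x 0 ≡ y 0 → ∀ n → x n ≡ y n
recurrence-unique p q x y p≢0 x-rec y-rec x₀≡y₀ zero    = x₀≡y₀
recurrence-unique p q x y p≢0 x-rec y-rec x₀≡y₀ (suc n) = *-cancelˡ-≡ (p≢0 n) (begin
  p n * x (suc n) ≡⟨ x-rec n ⟩
  q n * x n       ≡⟨ cong (q n *_) (recurrence-unique p q x y p≢0 x-rec y-rec x₀≡y₀ n) ⟩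
  q n * y n       ≡⟨ y-rec n ⟨
  p n * y (suc n) ∎)
  where open ≡-Reasoning

-- Hypergeometric terms

binom-suc : ∀ a k → nat (suc k) * binom a (suc k) ≡ (a - nat k) * binom a k
binom-suc a k = begin
  nat (suc k) * (falling a k * (a - nat k) * 1/[k+1]!)   ≡⟨ rearrange (nat (suc k)) (falling a k) (a - nat k) 1/[k+1]! ⟩
  (a - nat k) * (falling a k * (nat (suc k) * 1/[k+1]!)) ≡⟨ cong (λ t → (a - nat k) * (falling a k * t)) (nat*1/[m*n]≡1/n (suc k) (k !) {{_}} {{k !≢0}}) ⟩
  (a - nat k) * binom a k                               ∎
  where
  open ≡-Reasoning
  1/[k+1]! : ℚ
  1/[k+1]! = ((+ 1) / (suc k !)) {{suc k !≢0}}
  rearrange : ∀ n f x r → n * (f * x * r) ≡ x * (f * (n * r))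
  rearrange = solve-∀ ℚ-ring

nCk*k!*[n∸k]!≡n! : ∀ {n k} → k ≤ n → (n C k) ℕ.* (k ! ℕ.* (n ∸ k) !) ≡ n !
nCk*k!*[n∸k]!≡n! {n} {k} k≤n =
  trans (cong (ℕ._* (k ! ℕ.* (n ∸ k) !)) (nCk≡n!/k![n-k]! k≤n))
        (m/n*n≡m {{ℕP.m*n≢0 (k !) ((n ∸ k) !) {{k !≢0}} {{(n ∸ k) !≢0}}}} (k![n∸k]!∣n! k≤n))

[2m]Cm*m!*m!≡[2m]! : ∀ m → ((2 ℕ.* m) C m) ℕ.* (m ! ℕ.* m !) ≡ (2 ℕ.* m) !
[2m]Cm*m!*m!≡[2m]! m =
  subst (λ j → ((2 ℕ.* m) C m) ℕ.* (m ! ℕ.* j !) ≡ (2 ℕ.* m) !) 2m∸m≡m (nCk*k!*[n∸k]!≡n! (ℕP.m≤m+n m (m ℕ.+ 0)))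
  where
  2m∸m≡m : 2 ℕ.* m ∸ m ≡ m
  2m∸m≡m = trans (cong (λ j → m ℕ.+ j ∸ m) (ℕP.+-identityʳ m)) (ℕP.m+n∸m≡n m m)

central-binomial-suc : ∀ m → suc m ℕ.* ((2 ℕ.* suc m) C suc m) ≡ 2 ℕ.* (1 ℕ.+ 2 ℕ.* m) ℕ.* ((2 ℕ.* m) C m)
central-binomial-suc m = ℕP.*-cancelʳ-≡ _ _ (suc m ℕ.* (m ! ℕ.* m !)) {{ℕP.m*n≢0 (suc m) _ {{_}} {{ℕP.m*n≢0 (m !) (m !) {{m !≢0}} {{m !≢0}}}}}} (begin
  suc m ℕ.* C₁ ℕ.* (suc m ℕ.* (m ! ℕ.* m !))          ≡⟨ regroup₁ (suc m) C₁ (m !) ⟩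
  C₁ ℕ.* (suc m ! ℕ.* suc m !)                        ≡⟨ [2m]Cm*m!*m!≡[2m]! (suc m) ⟩
  (2 ℕ.* suc m) !                                      ≡⟨ cong _! (ℕP.*-distribˡ-+ 2 1 m) ⟩
  (2 ℕ.+ 2 ℕ.* m) !                                    ≡⟨ cong (λ t → (2 ℕ.+ 2 ℕ.* m) ℕ.* ((1 ℕ.+ 2 ℕ.* m) ℕ.* t)) ([2m]Cm*m!*m!≡[2m]! m) ⟨
  (2 ℕ.+ 2 ℕ.* m) ℕ.* ((1 ℕ.+ 2 ℕ.* m) ℕ.* (C₀ ℕ.* (m ! ℕ.* m !)))
                                                       ≡⟨ regroup₂ m C₀ (m !) ⟩
  2 ℕ.* (1 ℕ.+ 2 ℕ.* m) ℕ.* C₀ ℕ.* (suc m ℕ.* (m ! ℕ.* m !)) ∎)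
  where
  open ≡-Reasoning
  C₀ C₁ : ℕ
  C₀ = (2 ℕ.* m) C m
  C₁ = (2 ℕ.* suc m) C suc m
  regroup₁ : ∀ a c f → a ℕ.* c ℕ.* (a ℕ.* (f ℕ.* f)) ≡ c ℕ.* (a ℕ.* f ℕ.* (a ℕ.* f))
  regroup₁ = ℕ-Solver.solve-∀
  regroup₂ : ∀ m c f → (2 ℕ.+ 2 ℕ.* m) ℕ.* ((1 ℕ.+ 2 ℕ.* m) ℕ.* (c ℕ.* (f ℕ.* f)))
                       ≡ 2 ℕ.* (1 ℕ.+ 2 ℕ.* m) ℕ.* c ℕ.* (suc m ℕ.* (f ℕ.* f))
  regroup₂ = ℕ-Solver.solve-∀

central-binomial-suc-ℚ : ∀ m → (nat m + 1ℚ) * nat ((2 ℕ.* suc m) C suc m)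
                              ≡ nat 2 * (nat 2 * nat m + 1ℚ) * nat ((2 ℕ.* m) C m)
central-binomial-suc-ℚ m = begin
  (nat m + 1ℚ) * nat C₁                       ≡⟨ cong (_* nat C₁) (nat-suc m) ⟨
  nat (suc m) * nat C₁                        ≡⟨ nat-* (suc m) C₁ ⟨
  nat (suc m ℕ.* C₁)                          ≡⟨ cong nat (central-binomial-suc m) ⟩
  nat (2 ℕ.* (1 ℕ.+ 2 ℕ.* m) ℕ.* C₀)          ≡⟨ trans (nat-* (2 ℕ.* (1 ℕ.+ 2 ℕ.* m)) C₀) (cong (_* nat C₀) (nat-* 2 (1 ℕ.+ 2 ℕ.* m))) ⟩
  nat 2 * nat (1 ℕ.+ 2 ℕ.* m) * nat C₀        ≡⟨ cong (λ t → nat 2 * t * nat C₀) (trans (nat-suc (2 ℕ.* m)) (cong (_+ 1ℚ) (nat-* 2 m))) ⟩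
  nat 2 * (nat 2 * nat m + 1ℚ) * nat C₀       ∎
  where
  open ≡-Reasoning
  C₀ C₁ : ℕ
  C₀ = (2 ℕ.* m) C m
  C₁ = (2 ℕ.* suc m) C suc m

scaled-binom²-suc : ∀ s a k → (nat k + 1ℚ) * (nat k + 1ℚ) * (s ^ suc k * binom a (suc k) ^ 2)
                              ≡ s * (a - nat k) * (a - nat k) * (s ^ k * binom a k ^ 2)
scaled-binom²-suc s a k = substitute (nat k + 1ℚ) s (s ^ k) (binom a (suc k)) (a - nat k) (binom a k)
  (trans (cong (_* binom a (suc k)) (sym (nat-suc k))) (binom-suc a k))
  where
  substitute : ∀ N s P B′ A B → N * B′ ≡ A * B → N * N * (s * P * (B′ * (B′ * 1ℚ))) ≡ s * A * A * (P * (B * (B * 1ℚ)))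
  substitute N s P B′ A B NB′≡AB = begin
    N * N * (s * P * (B′ * (B′ * 1ℚ)))   ≡⟨ solve (N ∷ s ∷ P ∷ B′ ∷ []) ℚ-ring ⟩
    s * P * ((N * B′) * (N * B′))        ≡⟨ cong (λ t → s * P * (t * t)) NB′≡AB ⟩
    s * P * ((A * B) * (A * B))          ≡⟨ solve (s ∷ P ∷ A ∷ B ∷ []) ℚ-ring ⟩
    s * A * A * (P * (B * (B * 1ℚ)))     ∎
    where open ≡-Reasoning

-1/4 -3/4 : ℚ
-1/4 = -[1+ 0 ] / 4
-3/4 = -[1+ 2 ] / 4

u v w c : ℕ → ℚ
u k = nat 64 ^ k * (binom -1/4 k ^ 2)
v k = nat 64 ^ k * (binom -3/4 k ^ 2)
w k = nat ((2 ℕ.* k) C k) * nat 16 ^ k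
c k = nat ((2 ℕ.* k) C k) ^ 3

u-suc : ∀ k → (nat k + 1ℚ) * (nat k + 1ℚ) * u (suc k) ≡ nat 4 * (nat 4 * nat k + 1ℚ) * (nat 4 * nat k + 1ℚ) * u k
u-suc k = trans (scaled-binom²-suc (nat 64) -1/4 k) (cong (_* u k) (coefficient (nat k)))
  where
  coefficient : ∀ K → nat 64 * (-1/4 - K) * (-1/4 - K) ≡ nat 4 * (nat 4 * K + 1ℚ) * (nat 4 * K + 1ℚ)
  coefficient = solve-∀ ℚ-ring

v-suc : ∀ k → (nat k + 1ℚ) * (nat k + 1ℚ) * v (suc k) ≡ nat 4 * (nat 4 * nat k + nat 3) * (nat 4 * nat k + nat 3) * v k
v-suc k = trans (scaled-binom²-suc (nat 64) -3/4 k) (cong (_* v k) (coefficient (nat k)))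
  where
  coefficient : ∀ K → nat 64 * (-3/4 - K) * (-3/4 - K) ≡ nat 4 * (nat 4 * K + nat 3) * (nat 4 * K + nat 3)
  coefficient = solve-∀ ℚ-ring

w-suc : ∀ m → (nat m + 1ℚ) * w (suc m) ≡ nat 32 * (nat 2 * nat m + 1ℚ) * w m
w-suc m = substitute (nat m + 1ℚ) (nat ((2 ℕ.* suc m) C suc m)) (nat 2 * nat m + 1ℚ) (nat ((2 ℕ.* m) C m)) (nat 16 ^ m)
                     (central-binomial-suc-ℚ m)
  where
  substitute : ∀ N C₁ T C₀ P → N * C₁ ≡ nat 2 * T * C₀ → N * (C₁ * (nat 16 * P)) ≡ nat 32 * T * (C₀ * P)
  substitute N C₁ T C₀ P NC₁≡2TC₀ = begin
    N * (C₁ * (nat 16 * P))    ≡⟨ solve (N ∷ C₁ ∷ P ∷ []) ℚ-ring ⟩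
    nat 16 * (N * C₁) * P      ≡⟨ cong (λ t → nat 16 * t * P) NC₁≡2TC₀ ⟩
    nat 16 * (nat 2 * T * C₀) * P ≡⟨ solve (T ∷ C₀ ∷ P ∷ []) ℚ-ring ⟩
    nat 32 * T * (C₀ * P)      ∎
    where open ≡-Reasoning

c-suc : ∀ k → (nat k + 1ℚ) * (nat k + 1ℚ) * (nat k + 1ℚ) * c (suc k)
              ≡ nat 8 * (nat 2 * nat k + 1ℚ) * (nat 2 * nat k + 1ℚ) * (nat 2 * nat k + 1ℚ) * c k
c-suc k = substitute (nat k + 1ℚ) (nat ((2 ℕ.* suc k) C suc k)) (nat 2 * nat k + 1ℚ) (nat ((2 ℕ.* k) C k))
                     (central-binomial-suc-ℚ k)
  where
  substitute : ∀ N C₁ T C₀ → N * C₁ ≡ nat 2 * T * C₀ →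
               N * N * N * (C₁ * (C₁ * (C₁ * 1ℚ))) ≡ nat 8 * T * T * T * (C₀ * (C₀ * (C₀ * 1ℚ)))
  substitute N C₁ T C₀ NC₁≡2TC₀ = begin
    N * N * N * (C₁ * (C₁ * (C₁ * 1ℚ)))               ≡⟨ solve (N ∷ C₁ ∷ []) ℚ-ring ⟩
    (N * C₁) * (N * C₁) * (N * C₁)                    ≡⟨ cong (λ t → t * t * t) NC₁≡2TC₀ ⟩
    (nat 2 * T * C₀) * (nat 2 * T * C₀) * (nat 2 * T * C₀) ≡⟨ solve (T ∷ C₀ ∷ []) ℚ-ring ⟩
    nat 8 * T * T * T * (C₀ * (C₀ * (C₀ * 1ℚ)))       ∎
    where open ≡-Reasoning

-- Euler's transformation and Clausen's formula

-- (K + M + 1)² − K² = (M + 1)(2K + M + 1), so w₁ only enters through (M + 1) w₁ and both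
-- recurrences substitute without division.
euler-certificate : ∀ K M u₀ u₁ w₀ w₁ →
  (K + 1ℚ) * (K + 1ℚ) * u₁ ≡ nat 4 * (nat 4 * K + 1ℚ) * (nat 4 * K + 1ℚ) * u₀ →
  (M + 1ℚ) * w₁ ≡ nat 32 * (nat 2 * M + 1ℚ) * w₀ →
  (K + M + 1ℚ) * (K + M + 1ℚ) * (u₀ * w₁) + (K + 1ℚ) * (K + 1ℚ) * (u₁ * w₀)
    ≡ nat 4 * (nat 4 * (K + M) + nat 3) * (nat 4 * (K + M) + nat 3) * (u₀ * w₀) + K * K * (u₀ * w₁)
euler-certificate K M u₀ u₁ w₀ w₁ u-step w-step = begin
  (K + M + 1ℚ) * (K + M + 1ℚ) * (u₀ * w₁) + (K + 1ℚ) * (K + 1ℚ) * (u₁ * w₀)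
    ≡⟨ solve (K ∷ M ∷ u₀ ∷ u₁ ∷ w₀ ∷ w₁ ∷ []) ℚ-ring ⟩
  (nat 2 * K + M + 1ℚ) * u₀ * ((M + 1ℚ) * w₁) + (K + 1ℚ) * (K + 1ℚ) * u₁ * w₀ + K * K * (u₀ * w₁)
    ≡⟨ cong₂ (λ s t → (nat 2 * K + M + 1ℚ) * u₀ * s + t * w₀ + K * K * (u₀ * w₁)) w-step u-step ⟩
  (nat 2 * K + M + 1ℚ) * u₀ * (nat 32 * (nat 2 * M + 1ℚ) * w₀)
    + nat 4 * (nat 4 * K + 1ℚ) * (nat 4 * K + 1ℚ) * u₀ * w₀ + K * K * (u₀ * w₁)
    ≡⟨ solve (K ∷ M ∷ u₀ ∷ w₀ ∷ w₁ ∷ []) ℚ-ring ⟩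
  nat 4 * (nat 4 * (K + M) + nat 3) * (nat 4 * (K + M) + nat 3) * (u₀ * w₀) + K * K * (u₀ * w₁) ∎
  where open ≡-Reasoning

euler : ∀ n → (u ⋆ w) n ≡ v n
euler = recurrence-unique p q (u ⋆ w) v p≢0 (⋆-recurrence u w p q G G-left G-right certificate) v-suc refl
  where
  p q : ℕ → ℚ
  p n = (nat n + 1ℚ) * (nat n + 1ℚ)
  q n = nat 4 * (nat 4 * nat n + nat 3) * (nat 4 * nat n + nat 3)
  p≢0 : ∀ n → p n ≢ 0ℚ
  p≢0 n = p*q≢0 (nat+1≢0 n) (nat+1≢0 n)
  G : ℕ → ℕ → ℚ
  G k j = nat k * nat k * (u k * w j)
  G-left : ∀ j → G 0 j ≡ 0ℚ
  G-left j = ℚP.*-zeroˡ (u 0 * w j)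
  G-right : ∀ n → G (suc n) 0 ≡ p n * (u (suc n) * w 0)
  G-right n = cong (λ N → N * N * (u (suc n) * w 0)) (nat-suc n)
  certificate : ∀ k m → p (k ℕ.+ m) * (u k * w (suc m)) + G (suc k) m ≡ q (k ℕ.+ m) * (u k * w m) + G k (suc m)
  certificate k m rewrite nat-+ k m | nat-suc k =
    euler-certificate (nat k) (nat m) (u k) (u (suc k)) (w m) (w (suc m)) (u-suc k) (w-suc m)

-- Here (K + M + 1)³ − K²(K + 3M + 3) = (M + 1)²(3K + M + 1) plays the same role.
clausen-certificate : ∀ K M u₀ u₁ x₀ x₁ →
  (K + 1ℚ) * (K + 1ℚ) * u₁ ≡ nat 4 * (nat 4 * K + 1ℚ) * (nat 4 * K + 1ℚ) * u₀ →
  (M + 1ℚ) * (M + 1ℚ) * x₁ ≡ nat 4 * (nat 4 * M + 1ℚ) * (nat 4 * M + 1ℚ) * x₀ →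
  (K + M + 1ℚ) * (K + M + 1ℚ) * (K + M + 1ℚ) * (u₀ * x₁) + (K + 1ℚ) * (K + 1ℚ) * (K + 1ℚ + nat 3 * M) * (u₁ * x₀)
    ≡ nat 8 * (nat 2 * (K + M) + 1ℚ) * (nat 2 * (K + M) + 1ℚ) * (nat 2 * (K + M) + 1ℚ) * (u₀ * x₀)
      + K * K * (K + nat 3 * (M + 1ℚ)) * (u₀ * x₁)
clausen-certificate K M u₀ u₁ x₀ x₁ u-step x-step = begin
  (K + M + 1ℚ) * (K + M + 1ℚ) * (K + M + 1ℚ) * (u₀ * x₁) + (K + 1ℚ) * (K + 1ℚ) * (K + 1ℚ + nat 3 * M) * (u₁ * x₀)
    ≡⟨ solve (K ∷ M ∷ u₀ ∷ u₁ ∷ x₀ ∷ x₁ ∷ []) ℚ-ring ⟩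
  (nat 3 * K + M + 1ℚ) * u₀ * ((M + 1ℚ) * (M + 1ℚ) * x₁) + (K + 1ℚ) * (K + 1ℚ) * u₁ * ((K + 1ℚ + nat 3 * M) * x₀)
    + K * K * (K + nat 3 * (M + 1ℚ)) * (u₀ * x₁)
    ≡⟨ cong₂ (λ s t → (nat 3 * K + M + 1ℚ) * u₀ * s + t * ((K + 1ℚ + nat 3 * M) * x₀)
                      + K * K * (K + nat 3 * (M + 1ℚ)) * (u₀ * x₁)) x-step u-step ⟩
  (nat 3 * K + M + 1ℚ) * u₀ * (nat 4 * (nat 4 * M + 1ℚ) * (nat 4 * M + 1ℚ) * x₀)
    + nat 4 * (nat 4 * K + 1ℚ) * (nat 4 * K + 1ℚ) * u₀ * ((K + 1ℚ + nat 3 * M) * x₀)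
    + K * K * (K + nat 3 * (M + 1ℚ)) * (u₀ * x₁)
    ≡⟨ solve (K ∷ M ∷ u₀ ∷ x₀ ∷ x₁ ∷ []) ℚ-ring ⟩
  nat 8 * (nat 2 * (K + M) + 1ℚ) * (nat 2 * (K + M) + 1ℚ) * (nat 2 * (K + M) + 1ℚ) * (u₀ * x₀)
    + K * K * (K + nat 3 * (M + 1ℚ)) * (u₀ * x₁) ∎
  where open ≡-Reasoning

clausen : ∀ n → (u ⋆ u) n ≡ c n
clausen = recurrence-unique p q (u ⋆ u) c p≢0 (⋆-recurrence u u p q G G-left G-right certificate) c-suc refl
  where
  p q : ℕ → ℚ
  p n = (nat n + 1ℚ) * (nat n + 1ℚ) * (nat n + 1ℚ)
  q n = nat 8 * (nat 2 * nat n + 1ℚ) * (nat 2 * nat n + 1ℚ) * (nat 2 * nat n + 1ℚ)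
  p≢0 : ∀ n → p n ≢ 0ℚ
  p≢0 n = p*q≢0 (p*q≢0 (nat+1≢0 n) (nat+1≢0 n)) (nat+1≢0 n)
  G : ℕ → ℕ → ℚ
  G k j = nat k * nat k * (nat k + nat 3 * nat j) * (u k * u j)
  G-left : ∀ j → G 0 j ≡ 0ℚ
  G-left j = trans (cong (_* (u 0 * u j)) (ℚP.*-zeroˡ (nat 0 + nat 3 * nat j))) (ℚP.*-zeroˡ (u 0 * u j))
  G-right : ∀ n → G (suc n) 0 ≡ p n * (u (suc n) * u 0)
  G-right n rewrite nat-suc n = drop-zero (nat n + 1ℚ) (u (suc n) * u 0)
    where
    drop-zero : ∀ N y → N * N * (N + nat 3 * nat 0) * y ≡ N * N * N * y
    drop-zero = solve-∀ ℚ-ring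
  certificate : ∀ k m → p (k ℕ.+ m) * (u k * u (suc m)) + G (suc k) m ≡ q (k ℕ.+ m) * (u k * u m) + G k (suc m)
  certificate k m rewrite nat-+ k m | nat-suc k | nat-suc m =
    clausen-certificate (nat k) (nat m) (u k) (u (suc k)) (u m) (u (suc m)) (u-suc k) (u-suc m)

lemma3p1 : ∀ (n : ℕ) →
    (nat 64 ^ n) * sumTo n (λ k → (binom (-[1+ 0 ] / 4) k ^ 2) * (binom (-[1+ 2 ] / 4) (n ∸ k) ^ 2))
      ≡ sumTo n (λ k → (nat ((2 ℕ.* k) C k) ^ 3) * (nat ((2 ℕ.* (n ∸ k)) C (n ∸ k)) * (nat 16 ^ (n ∸ k))))
lemma3p1 n = begin
  nat 64 ^ n * sumTo n (λ k → binom -1/4 k ^ 2 * binom -3/4 (n ∸ k) ^ 2)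
    ≡⟨ *-distribˡ-sumTo (nat 64 ^ n) n _ ⟩
  sumTo n (λ k → nat 64 ^ n * (binom -1/4 k ^ 2 * binom -3/4 (n ∸ k) ^ 2))
    ≡⟨ sumTo-cong n split-power ⟩
  (u ⋆ v) n          ≡⟨ sumTo-cong n (λ {k} _ → cong (u k *_) (euler (n ∸ k))) ⟨
  (u ⋆ (u ⋆ w)) n    ≡⟨ ⋆-assoc u u w n ⟩
  ((u ⋆ u) ⋆ w) n    ≡⟨ sumTo-cong n (λ {k} _ → cong (_* w (n ∸ k)) (clausen k)) ⟩
  (c ⋆ w) n          ∎
  where
  open ≡-Reasoning
  split-power : ∀ {k} → k ≤ n → nat 64 ^ n * (binom -1/4 k ^ 2 * binom -3/4 (n ∸ k) ^ 2) ≡ u k * v (n ∸ k)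
  split-power {k} k≤n =
    trans (cong (_* (binom -1/4 k ^ 2 * binom -3/4 (n ∸ k) ^ 2))
                (trans (cong (nat 64 ^_) (sym (ℕP.m+[n∸m]≡n k≤n))) (^-distribˡ-+-* (nat 64) k (n ∸ k))))
          (interchange* (nat 64 ^ k) (nat 64 ^ (n ∸ k)) (binom -1/4 k ^ 2) (binom -3/4 (n ∸ k) ^ 2))
    where
    interchange* : ∀ a b x y → a * b * (x * y) ≡ a * x * (b * y)
    interchange* = solve-∀ ℚ-ring
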